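{- For any $\varepsilon, C, \alpha > 0$ there exists $N = N_{\varepsilon, C, \alpha} > 0$ with the following property. Let $G$ be a bipartite graph with bipartition $(L,R)$ such that $n := v(G) \ge N$ and $\delta(G) \ge C n^{\alpha}$. Then there exists an $\varepsilon$-good partition of $L$.
   Context: $v(G)$ is the number of vertices and $\delta(G)$ the minimum degree of $G$. For a bipartite graph $G$ with bipartition $(L,R)$ and $\varepsilon>0$, a partition $(L_1,L_2)$ of $L$ is $\varepsilon$-good if for every $v \in R$ and $i \in\{1,2\}$, $\bigl||N(v)\cap L_i| - \deg(v)/2\bigr| \le \varepsilon \deg(v)$, where $N(v)$ and $\deg(v)$ are the neighborhood and degree of $v$.
   Formalization: The parameters ε, C and α range over the positive rationals. -}

module Defs where

open import Data.Nat as ℕ using (ℕ; zero; suc)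
open import Data.Bool using (Bool; true; false; if_then_else_; _∧_; not)
open import Data.Fin using (Fin; zero; suc)
open import Data.Integer using (+_)
open import Data.Rational as ℚ using (ℚ; _/_; _*_; _-_; ∣_∣; _≤_; 1ℚ)
open import Data.Product using (_×_)

count : {n : ℕ} → (Fin n → Bool) → ℕ
count {zero}  P = 0
count {suc n} P = (if P zero then 1 else 0) ℕ.+ count {n} (λ i → P (suc i))

ℕtoℚ : ℕ → ℚ
ℕtoℚ k = + k / 1

_^ℚ_ : ℚ → ℕ → ℚ
x ^ℚ zero  = 1ℚ
x ^ℚ suc k = x * (x ^ℚ k)

record BipGraph : Set where
  field
    l r : ℕ
    adj : Fin l → Fin r → Bool
open BipGraph public

nV : BipGraph → ℕ
nV G = l G ℕ.+ r G

degL : (G : BipGraph) → Fin (l G) → ℕ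
degL G u = count (λ v → adj G u v)

degR : (G : BipGraph) → Fin (r G) → ℕ
degR G v = count (λ u → adj G u v)

-- δ(G) ≥ C · n^(p/q), written as C^q · n^p ≤ deg(w)^q for every vertex w
-- (equivalent, since all quantities are nonnegative and q > 0)
MinDegAtLeast : (G : BipGraph) → (C : ℚ) → (p q : ℕ) → Set
MinDegAtLeast G C p q =
  ((u : Fin (l G)) → (C ^ℚ q) * (ℕtoℚ (nV G) ^ℚ p) ≤ ℕtoℚ (degL G u) ^ℚ q) ×
  ((v : Fin (r G)) → (C ^ℚ q) * (ℕtoℚ (nV G) ^ℚ p) ≤ ℕtoℚ (degR G v) ^ℚ q)

-- A partition (L₁, L₂) of L is encoded by σ : L → Bool,
-- L₁ = σ⁻¹(true), L₂ = σ⁻¹(false).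
-- Part i ∈ {1,2}: side true / false.
-- |N(v) ∩ L_side|
degInPart : (G : BipGraph) → (Fin (l G) → Bool) → Bool → Fin (r G) → ℕ
degInPart G σ side v = count (λ u → adj G u v ∧ (if side then σ u else not (σ u)))

EpsGood : (G : BipGraph) → ℚ → (Fin (l G) → Bool) → Set
EpsGood G ε σ = (v : Fin (r G)) → (side : Bool) →
  ∣ ℕtoℚ (degInPart G σ side v) - (+ degR G v / 2) ∣ ≤ ε * ℕtoℚ (degR G v)

{-# OPTIONS --safe #-}
-- Instead of choosing σ at random we count: sums over all 2^l partitions σ of L play the
-- role of expectations. For v ∈ R of degree d, every pattern on N(v) extends to the same
-- number 2^(l-d) of partitions, so the pair (|N(v) ∩ L₁|, |N(v) ∩ L₂|) is distributed like
-- the numbers of trues and falses of a word τ : Fin d → Bool. An exponential-moment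
-- (Chernoff) bound with integer weights shows that at most 2ρ^d of the 2^d words are
-- lopsided, for some ρ < 1 depending only on ε. The degree condition gives n ≤ K d^q, so
-- once n is large every d is large, and ρ^d beats the polynomial |R| + 1 ≤ K d^q + 1. A
-- union bound over R then leaves a partition that is balanced at every vertex.
module Submission where

open import Defs
open import Data.Nat using (ℕ; _≥_; _>_)
open import Data.Bool using (Bool)
open import Data.Fin using (Fin)
open import Data.Product using (Σ; ∃; _×_)
open import Data.Rational using (ℚ; Positive)

open import Algebra.Bundles using (CommutativeMonoid)
open import Data.Bool using (true; false; _∧_; not)
open import Data.Fin using (zero; suc)
open import Data.Integer as ℤ using (+_; +0; +[1+_]; -[1+_]; +≤+)
import Data.Integer.Properties as ℤ
import Data.Integer.Tactic.RingSolver as ℤ-Solver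
open import Data.Nat
open import Data.Nat.Coprimality using (Coprime)
open import Data.Nat.Properties
open import Data.Nat.Tactic.RingSolver using (solve-∀)
open import Data.Product using (_,_; proj₁; proj₂; ∃-syntax)
open import Data.Rational as ℚ using (mkℚ)
import Data.Rational.Properties as ℚ
open import Data.Rational.Unnormalised as ℚᵘ using (mkℚᵘ; *≤*; *≡*)
import Data.Rational.Unnormalised.Properties as ℚᵘ
open import Data.Sum using (inj₁; inj₂)
open import Data.Vec.Functional using ([]; _∷_)
open import Function using (_∘_)
open import Relation.Binary.PropositionalEquality
open import Relation.Nullary using (yes; no; contradiction)
open import Algebra.Properties.CommutativeMonoid.Sum +-0-commutativeMonoid
  using (sum-syntax; ∑-distrib-+)
open import Algebra.Properties.CommutativeSemigroup +-commutativeSemigroup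
  using () renaming (interchange to +-interchange)
open import Algebra.Properties.CommutativeSemigroup *-commutativeSemigroup
  using (x∙yz≈y∙xz; interchange)
open import Algebra.Properties.CommutativeSemigroup
  (CommutativeMonoid.commutativeSemigroup ℚ.*-1-commutativeMonoid)
  using () renaming (interchange to ℚ-interchange)

-- Sums over all 2-colourings σ : Fin l → Bool

sumBoolFuns : (l : ℕ) → ((Fin l → Bool) → ℕ) → ℕ
sumBoolFuns zero    F = F []
sumBoolFuns (suc l) F = sumBoolFuns l (F ∘ (true ∷_)) + sumBoolFuns l (F ∘ (false ∷_))

sumBoolFuns-cong : ∀ l {F G : (Fin l → Bool) → ℕ} → (∀ σ → F σ ≡ G σ) →
                   sumBoolFuns l F ≡ sumBoolFuns l G
sumBoolFuns-cong zero    F≡G = F≡G []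
sumBoolFuns-cong (suc l) F≡G =
  cong₂ _+_ (sumBoolFuns-cong l (F≡G ∘ (true ∷_))) (sumBoolFuns-cong l (F≡G ∘ (false ∷_)))

sumBoolFuns-mono-≤ : ∀ l {F G : (Fin l → Bool) → ℕ} → (∀ σ → F σ ≤ G σ) →
                     sumBoolFuns l F ≤ sumBoolFuns l G
sumBoolFuns-mono-≤ zero    F≤G = F≤G []
sumBoolFuns-mono-≤ (suc l) F≤G =
  +-mono-≤ (sumBoolFuns-mono-≤ l (F≤G ∘ (true ∷_))) (sumBoolFuns-mono-≤ l (F≤G ∘ (false ∷_)))

sumBoolFuns-distrib-+ : ∀ l (F G : (Fin l → Bool) → ℕ) →
  sumBoolFuns l (λ σ → F σ + G σ) ≡ sumBoolFuns l F + sumBoolFuns l G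
sumBoolFuns-distrib-+ zero    F G = refl
sumBoolFuns-distrib-+ (suc l) F G = trans
  (cong₂ _+_ (sumBoolFuns-distrib-+ l (F ∘ (true ∷_)) (G ∘ (true ∷_)))
             (sumBoolFuns-distrib-+ l (F ∘ (false ∷_)) (G ∘ (false ∷_))))
  (+-interchange (sumBoolFuns l (F ∘ (true ∷_))) (sumBoolFuns l (G ∘ (true ∷_)))
                 (sumBoolFuns l (F ∘ (false ∷_))) (sumBoolFuns l (G ∘ (false ∷_))))

*-distribˡ-sumBoolFuns : ∀ l c (F : (Fin l → Bool) → ℕ) →
  c * sumBoolFuns l F ≡ sumBoolFuns l (λ σ → c * F σ)
*-distribˡ-sumBoolFuns zero    c F = refl
*-distribˡ-sumBoolFuns (suc l) c F = trans (*-distribˡ-+ c _ _)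
  (cong₂ _+_ (*-distribˡ-sumBoolFuns l c (F ∘ (true ∷_))) (*-distribˡ-sumBoolFuns l c (F ∘ (false ∷_))))

sumBoolFuns-∑-comm : ∀ l {r} (H : Fin r → (Fin l → Bool) → ℕ) →
  sumBoolFuns l (λ σ → ∑[ v < r ] H v σ) ≡ ∑[ v < r ] sumBoolFuns l (H v)
sumBoolFuns-∑-comm zero    H = refl
sumBoolFuns-∑-comm (suc l) H = trans
  (cong₂ _+_ (sumBoolFuns-∑-comm l (λ v → H v ∘ (true ∷_))) (sumBoolFuns-∑-comm l (λ v → H v ∘ (false ∷_))))
  (sym (∑-distrib-+ (λ v → sumBoolFuns l (H v ∘ (true ∷_))) (λ v → sumBoolFuns l (H v ∘ (false ∷_)))))

sumBoolFuns<2^l⇒∃F≡0 : ∀ l (F : (Fin l → Bool) → ℕ) → sumBoolFuns l F < 2 ^ l → ∃[ σ ] F σ ≡ 0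
sumBoolFuns<2^l⇒∃F≡0 zero    F F[]<1 = [] , n<1⇒n≡0 F[]<1
sumBoolFuns<2^l⇒∃F≡0 (suc l) F S<2^[1+l]
  with sumBoolFuns l (F ∘ (true ∷_)) <? 2 ^ l
... | yes S₁<2^l = let σ , Fσ≡0 = sumBoolFuns<2^l⇒∃F≡0 l (F ∘ (true ∷_)) S₁<2^l in true ∷ σ , Fσ≡0
... | no  S₁≮2^l = let σ , Fσ≡0 = sumBoolFuns<2^l⇒∃F≡0 l (F ∘ (false ∷_)) S₂<2^l in false ∷ σ , Fσ≡0
  where
  open ≤-Reasoning
  S₂<2^l : sumBoolFuns l (F ∘ (false ∷_)) < 2 ^ l
  S₂<2^l = +-cancelˡ-< (2 ^ l) _ _ (begin-strict
    2 ^ l + sumBoolFuns l (F ∘ (false ∷_))  ≤⟨ +-monoˡ-≤ _ (≮⇒≥ S₁≮2^l) ⟩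
    sumBoolFuns (suc l) F                  <⟨ S<2^[1+l] ⟩
    2 ^ l + (2 ^ l + 0)                    ≡⟨ cong (_+_ (2 ^ l)) (+-identityʳ (2 ^ l)) ⟩
    2 ^ l + 2 ^ l                          ∎)

∑f≡0⇒f≡0 : ∀ {r} (f : Fin r → ℕ) → ∑[ v < r ] f v ≡ 0 → ∀ v → f v ≡ 0
∑f≡0⇒f≡0 f ∑f≡0 zero    = m+n≡0⇒m≡0 (f zero) ∑f≡0
∑f≡0⇒f≡0 f ∑f≡0 (suc v) = ∑f≡0⇒f≡0 (f ∘ suc) (m+n≡0⇒n≡0 (f zero) ∑f≡0) v

[∑f]*m≤r*n : ∀ {r} (f : Fin r → ℕ) m n → (∀ v → f v * m ≤ n) → (∑[ v < r ] f v) * m ≤ r * n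
[∑f]*m≤r*n {zero}  f m n f*m≤n = z≤n
[∑f]*m≤r*n {suc r} f m n f*m≤n = begin
  (f zero + ∑[ v < r ] f (suc v)) * m        ≡⟨ *-distribʳ-+ m (f zero) _ ⟩
  f zero * m + (∑[ v < r ] f (suc v)) * m    ≤⟨ +-mono-≤ (f*m≤n zero) ([∑f]*m≤r*n (f ∘ suc) m n (f*m≤n ∘ suc)) ⟩
  n + r * n                                  ∎
  where open ≤-Reasoning

union-bound : ∀ l {r} (H : Fin r → (Fin l → Bool) → ℕ) →
  (∀ v → sumBoolFuns l (H v) * suc r ≤ 2 ^ l) → ∃[ σ ] ∀ v → H v σ ≡ 0
union-bound l {r} H rare =
  let σ , ∑Hσ≡0 = sumBoolFuns<2^l⇒∃F≡0 l (λ σ → ∑[ v < r ] H v σ) total<2^l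
  in  σ , ∑f≡0⇒f≡0 (λ v → H v σ) ∑Hσ≡0
  where
  open ≤-Reasoning
  total<2^l : sumBoolFuns l (λ σ → ∑[ v < r ] H v σ) < 2 ^ l
  total<2^l = *-cancelʳ-< (suc r) _ _ (begin-strict
    sumBoolFuns l (λ σ → ∑[ v < r ] H v σ) * suc r ≡⟨ cong (_* suc r) (sumBoolFuns-∑-comm l H) ⟩
    (∑[ v < r ] sumBoolFuns l (H v)) * suc r     ≤⟨ [∑f]*m≤r*n (λ v → sumBoolFuns l (H v)) (suc r) (2 ^ l) rare ⟩
    r * 2 ^ l                                    <⟨ +-monoˡ-< (r * 2 ^ l) (m^n>0 2 l) ⟩
    suc r * 2 ^ l                                ≡⟨ *-comm (suc r) (2 ^ l) ⟩
    2 ^ l * suc r                                ∎)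

count+count-not : ∀ {n} (τ : Fin n → Bool) → count τ + count (not ∘ τ) ≡ n
count+count-not {zero}  τ = refl
count+count-not {suc n} τ with τ zero
... | true  = cong suc (count+count-not (τ ∘ suc))
... | false = trans (+-suc _ _) (cong suc (count+count-not (τ ∘ suc)))

count-∧-split : ∀ {l} (A σ : Fin l → Bool) → count (λ u → A u ∧ σ u) + count (λ u → A u ∧ not (σ u)) ≡ count A
count-∧-split {zero}  A σ = refl
count-∧-split {suc l} A σ with A zero | σ zero
... | false | _     = count-∧-split (A ∘ suc) (σ ∘ suc)
... | true  | true  = cong suc (count-∧-split (A ∘ suc) (σ ∘ suc))
... | true  | false = trans (+-suc _ _) (cong suc (count-∧-split (A ∘ suc) (σ ∘ suc)))

sumBoolFuns-binomial : ∀ d X Y →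
  sumBoolFuns d (λ τ → X ^ count τ * Y ^ count (not ∘ τ)) ≡ (X + Y) ^ d
sumBoolFuns-binomial zero    X Y = refl
sumBoolFuns-binomial (suc d) X Y = begin
  sumBoolFuns d (λ τ → X * X ^ count τ * Y ^ count (not ∘ τ))
    + sumBoolFuns d (λ τ → X ^ count τ * (Y * Y ^ count (not ∘ τ)))
    ≡⟨ cong₂ _+_ (sumBoolFuns-cong d (λ τ → *-assoc X _ _))
                 (sumBoolFuns-cong d (λ τ → x∙yz≈y∙xz (X ^ count τ) Y _)) ⟩
  sumBoolFuns d (λ τ → X * B τ) + sumBoolFuns d (λ τ → Y * B τ)
    ≡⟨ cong₂ _+_ (*-distribˡ-sumBoolFuns d X B) (*-distribˡ-sumBoolFuns d Y B) ⟨
  X * sumBoolFuns d B + Y * sumBoolFuns d B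
    ≡⟨ *-distribʳ-+ _ X Y ⟨
  (X + Y) * sumBoolFuns d B
    ≡⟨ cong ((X + Y) *_) (sumBoolFuns-binomial d X Y) ⟩
  (X + Y) * (X + Y) ^ d ∎
  where
  open ≡-Reasoning
  B : (Fin d → Bool) → ℕ
  B τ = X ^ count τ * Y ^ count (not ∘ τ)

-- Every colouring τ of the support of A extends to 2^(l - |A|) colourings σ of Fin l.
sumBoolFuns-restrict : ∀ l (A : Fin l → Bool) (g : ℕ → ℕ → ℕ) →
  sumBoolFuns l (λ σ → g (count (λ u → A u ∧ σ u)) (count (λ u → A u ∧ not (σ u)))) * 2 ^ count A
    ≡ 2 ^ l * sumBoolFuns (count A) (λ τ → g (count τ) (count (not ∘ τ)))
sumBoolFuns-restrict zero    A g = *-comm (g 0 0) 1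
sumBoolFuns-restrict (suc l) A g with A zero
... | false = begin
  (S + S) * P          ≡⟨ *-distribʳ-+ P S S ⟩
  S * P + S * P        ≡⟨ cong₂ _+_ IH IH ⟩
  L * T + L * T        ≡⟨ *-distribʳ-+ T L L ⟨
  (L + L) * T          ≡⟨ cong (λ x → (L + x) * T) (+-identityʳ L) ⟨
  2 * L * T            ∎
  where
  open ≡-Reasoning
  A′ : Fin l → Bool
  A′ = A ∘ suc
  S T P L : ℕ
  S = sumBoolFuns l (λ σ → g (count (λ u → A′ u ∧ σ u)) (count (λ u → A′ u ∧ not (σ u))))
  T = sumBoolFuns (count A′) (λ τ → g (count τ) (count (not ∘ τ)))
  P = 2 ^ count A′
  L = 2 ^ l
  IH : S * P ≡ L * T
  IH = sumBoolFuns-restrict l A′ g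
... | true = begin
  (S₁ + S₂) * (2 * P)      ≡⟨ x∙yz≈y∙xz (S₁ + S₂) 2 P ⟩
  2 * ((S₁ + S₂) * P)      ≡⟨ cong (2 *_) (*-distribʳ-+ P S₁ S₂) ⟩
  2 * (S₁ * P + S₂ * P)    ≡⟨ cong (2 *_) (cong₂ _+_ IH₁ IH₂) ⟩
  2 * (L * T₁ + L * T₂)    ≡⟨ cong (2 *_) (*-distribˡ-+ L T₁ T₂) ⟨
  2 * (L * (T₁ + T₂))      ≡⟨ *-assoc 2 L (T₁ + T₂) ⟨
  2 * L * (T₁ + T₂)        ∎
  where
  open ≡-Reasoning
  A′ : Fin l → Bool
  A′ = A ∘ suc
  S₁ S₂ T₁ T₂ P L : ℕ
  S₁ = sumBoolFuns l (λ σ → g (suc (count (λ u → A′ u ∧ σ u))) (count (λ u → A′ u ∧ not (σ u))))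
  S₂ = sumBoolFuns l (λ σ → g (count (λ u → A′ u ∧ σ u)) (suc (count (λ u → A′ u ∧ not (σ u)))))
  T₁ = sumBoolFuns (count A′) (λ τ → g (suc (count τ)) (count (not ∘ τ)))
  T₂ = sumBoolFuns (count A′) (λ τ → g (count τ) (suc (count (not ∘ τ))))
  P = 2 ^ count A′
  L = 2 ^ l
  IH₁ : S₁ * P ≡ L * T₁
  IH₁ = sumBoolFuns-restrict l A′ (λ k j → g (suc k) j)
  IH₂ : S₂ * P ≡ L * T₂
  IH₂ = sumBoolFuns-restrict l A′ (λ k j → g k (suc j))

-- Exponential versus polynomial growth

[1+s+e]^s*e≤[s+e]^[1+s] : ∀ s e → suc (s + e) ^ s * e ≤ (s + e) ^ suc s
[1+s+e]^s*e≤[s+e]^[1+s] zero    e = ≤-reflexive (trans (+-identityʳ e) (sym (*-identityʳ e)))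
[1+s+e]^s*e≤[s+e]^[1+s] (suc s) e = begin
  suc D * suc D ^ s * e   ≡⟨ *-assoc (suc D) (suc D ^ s) e ⟩
  suc D * (suc D ^ s * e) ≡⟨ x∙yz≈y∙xz (suc D) (suc D ^ s) e ⟩
  suc D ^ s * (suc D * e) ≤⟨ *-monoʳ-≤ (suc D ^ s) [1+D]*e≤D*[1+e] ⟩
  suc D ^ s * (D * suc e) ≡⟨ x∙yz≈y∙xz (suc D ^ s) D (suc e) ⟩
  D * (suc D ^ s * suc e) ≤⟨ *-monoʳ-≤ D IH ⟩
  D * D ^ suc s           ∎
  where
  open ≤-Reasoning
  D : ℕ
  D = suc s + e
  [1+D]*e≤D*[1+e] : suc D * e ≤ D * suc e
  [1+D]*e≤D*[1+e] = subst (suc D * e ≤_) (sym (*-suc D e)) (+-monoˡ-≤ (D * e) (m≤n+m e (suc s)))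
  IH : suc D ^ s * suc e ≤ D ^ suc s
  IH = subst (λ x → suc x ^ s * suc e ≤ x ^ suc s) (+-suc s e) ([1+s+e]^s*e≤[s+e]^[1+s] s (suc e))

c*[1+D]^s≤[1+c]*D^s : ∀ c s D .{{_ : NonZero c}} .{{_ : NonZero s}} → suc c * s ≤ D →
                      c * suc D ^ s ≤ suc c * D ^ s
c*[1+D]^s≤[1+c]*D^s c s D [1+c]*s≤D with m≤n⇒∃[o]m+o≡n (≤-trans (m≤m+n s (c * s)) [1+c]*s≤D)
... | e , refl = *-cancelˡ-≤ e {{e≢0}} (begin
  e * (c * suc D ^ s)   ≡⟨ x∙yz≈y∙xz e c (suc D ^ s) ⟩
  c * (e * suc D ^ s)   ≡⟨ cong (c *_) (*-comm e (suc D ^ s)) ⟩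
  c * (suc D ^ s * e)   ≤⟨ *-monoʳ-≤ c ([1+s+e]^s*e≤[s+e]^[1+s] s e) ⟩
  c * (D * D ^ s)       ≡⟨ *-assoc c D (D ^ s) ⟨
  c * D * D ^ s         ≤⟨ *-monoˡ-≤ (D ^ s) c*D≤[1+c]*e ⟩
  suc c * e * D ^ s     ≡⟨ cong (_* D ^ s) (*-comm (suc c) e) ⟩
  e * suc c * D ^ s     ≡⟨ *-assoc e (suc c) (D ^ s) ⟩
  e * (suc c * D ^ s)   ∎)
  where
  open ≤-Reasoning
  c*s≤e : c * s ≤ e
  c*s≤e = +-cancelˡ-≤ s (c * s) e [1+c]*s≤D
  e≢0 : NonZero e
  e≢0 = >-nonZero (≤-trans (>-nonZero⁻¹ (c * s) {{m*n≢0 c s}}) c*s≤e)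
  c*D≤[1+c]*e : c * D ≤ suc c * e
  c*D≤[1+c]*e = begin
    c * (s + e)   ≡⟨ *-distribˡ-+ c s e ⟩
    c * s + c * e ≤⟨ +-monoˡ-≤ (c * e) c*s≤e ⟩
    e + c * e     ∎

c^t*[D+t]^s≤[1+c]^t*D^s : ∀ c s D .{{_ : NonZero c}} .{{_ : NonZero s}} → suc c * s ≤ D →
                          ∀ t → c ^ t * (D + t) ^ s ≤ suc c ^ t * D ^ s
c^t*[D+t]^s≤[1+c]^t*D^s c s D [1+c]*s≤D zero =
  ≤-reflexive (cong (λ x → 1 * x ^ s) (+-identityʳ D))
c^t*[D+t]^s≤[1+c]^t*D^s c s D [1+c]*s≤D (suc t) = begin
  c * c ^ t * (D + suc t) ^ s       ≡⟨ cong (λ x → c * c ^ t * x ^ s) (+-suc D t) ⟩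
  c * c ^ t * suc (D + t) ^ s       ≡⟨ *-assoc c (c ^ t) (suc (D + t) ^ s) ⟩
  c * (c ^ t * suc (D + t) ^ s)     ≡⟨ x∙yz≈y∙xz c (c ^ t) (suc (D + t) ^ s) ⟩
  c ^ t * (c * suc (D + t) ^ s)     ≤⟨ *-monoʳ-≤ (c ^ t) ratio ⟩
  c ^ t * (suc c * (D + t) ^ s)     ≡⟨ x∙yz≈y∙xz (c ^ t) (suc c) ((D + t) ^ s) ⟩
  suc c * (c ^ t * (D + t) ^ s)     ≤⟨ *-monoʳ-≤ (suc c) (c^t*[D+t]^s≤[1+c]^t*D^s c s D [1+c]*s≤D t) ⟩
  suc c * (suc c ^ t * D ^ s)       ≡⟨ *-assoc (suc c) (suc c ^ t) (D ^ s) ⟨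
  suc c * suc c ^ t * D ^ s         ∎
  where
  open ≤-Reasoning
  ratio : c * suc (D + t) ^ s ≤ suc c * (D + t) ^ s
  ratio = c*[1+D]^s≤[1+c]*D^s c s (D + t) (≤-trans [1+c]*s≤D (m≤m+n D t))

exp-dominates-poly : ∀ c .{{_ : NonZero c}} B q →
                     ∃[ D₀ ] ∀ d → D₀ ≤ d → c ^ d * (B * d ^ q) ≤ suc c ^ d
exp-dominates-poly c B q = D₁ + B * E , bound
  where
  D₁ E : ℕ
  D₁ = suc c * suc q
  E  = c ^ D₁ * D₁ ^ suc q
  instance
    E≢0 : NonZero E
    E≢0 = m*n≢0 (c ^ D₁) (D₁ ^ suc q) {{m^n≢0 c D₁}} {{m^n≢0 D₁ (suc q)}}
  bound : ∀ d → D₁ + B * E ≤ d → c ^ d * (B * d ^ q) ≤ suc c ^ d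
  bound d D₀≤d with m≤n⇒∃[o]m+o≡n (≤-trans (m≤m+n D₁ (B * E)) D₀≤d)
  ... | t , refl = *-cancelˡ-≤ E (begin
    E * (c ^ d * (B * d ^ q))           ≡⟨ rearrange E (c ^ d) B (d ^ q) ⟩
    c ^ d * (B * E * d ^ q)             ≤⟨ *-monoʳ-≤ (c ^ d) (*-monoˡ-≤ (d ^ q) (≤-trans (m≤n+m (B * E) D₁) D₀≤d)) ⟩
    c ^ d * d ^ suc q                   ≡⟨ cong (_* d ^ suc q) (^-distribˡ-+-* c D₁ t) ⟩
    c ^ D₁ * c ^ t * d ^ suc q          ≡⟨ *-assoc (c ^ D₁) (c ^ t) (d ^ suc q) ⟩
    c ^ D₁ * (c ^ t * d ^ suc q)        ≤⟨ *-monoʳ-≤ (c ^ D₁) (c^t*[D+t]^s≤[1+c]^t*D^s c (suc q) D₁ ≤-refl t) ⟩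
    c ^ D₁ * (suc c ^ t * D₁ ^ suc q)   ≡⟨ x∙yz≈y∙xz (c ^ D₁) (suc c ^ t) (D₁ ^ suc q) ⟩
    suc c ^ t * E                       ≡⟨ *-comm (suc c ^ t) E ⟩
    E * suc c ^ t                       ≤⟨ *-monoʳ-≤ E (^-monoʳ-≤ (suc c) (m≤n+m t D₁)) ⟩
    E * suc c ^ d                       ∎)
    where
    open ≤-Reasoning
    rearrange : ∀ e x b y → e * (x * (b * y)) ≡ x * (b * e * y)
    rearrange = solve-∀

-- A Chernoff bound for lopsided words

^-distribʳ-* : ∀ m n o → (m * n) ^ o ≡ m ^ o * n ^ o
^-distribʳ-* m n zero    = refl
^-distribʳ-* m n (suc o) = trans (cong (m * n *_) (^-distribʳ-* m n o)) (interchange m n (m ^ o) (n ^ o))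

m≤n⇒n^i*m^[j+e]≤n^[i+e]*m^j : ∀ {m n} → m ≤ n → ∀ i j e → n ^ i * m ^ (j + e) ≤ n ^ (i + e) * m ^ j
m≤n⇒n^i*m^[j+e]≤n^[i+e]*m^j {m} {n} m≤n i j e = begin
  n ^ i * m ^ (j + e)       ≡⟨ cong (n ^ i *_) (^-distribˡ-+-* m j e) ⟩
  n ^ i * (m ^ j * m ^ e)   ≤⟨ *-monoʳ-≤ (n ^ i) (*-monoʳ-≤ (m ^ j) (^-monoˡ-≤ e m≤n)) ⟩
  n ^ i * (m ^ j * n ^ e)   ≡⟨ cong (n ^ i *_) (*-comm (m ^ j) (n ^ e)) ⟩
  n ^ i * (n ^ e * m ^ j)   ≡⟨ *-assoc (n ^ i) (n ^ e) (m ^ j) ⟨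
  n ^ i * n ^ e * m ^ j     ≡⟨ cong (_* m ^ j) (^-distribˡ-+-* n i e) ⟨
  n ^ (i + e) * m ^ j       ∎
  where open ≤-Reasoning

[1+w]^[1+s]≤w^[1+s]+[1+s]*[1+w]^s : ∀ w s → suc w ^ suc s ≤ w ^ suc s + suc s * suc w ^ s
[1+w]^[1+s]≤w^[1+s]+[1+s]*[1+w]^s w zero    = ≤-reflexive (identity w)
  where
  identity : ∀ w → suc w * 1 ≡ w * 1 + 1 * 1
  identity = solve-∀
[1+w]^[1+s]≤w^[1+s]+[1+s]*[1+w]^s w (suc s) = begin
  suc w * suc w ^ suc s
    ≤⟨ *-monoʳ-≤ (suc w) ([1+w]^[1+s]≤w^[1+s]+[1+s]*[1+w]^s w s) ⟩
  suc w * (w ^ suc s + suc s * suc w ^ s)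
    ≡⟨ expand w (w ^ suc s) s (suc w ^ s) ⟩
  w * w ^ suc s + (w ^ suc s + suc s * suc w ^ suc s)
    ≤⟨ +-monoʳ-≤ (w * w ^ suc s) (+-monoˡ-≤ _ (^-monoˡ-≤ (suc s) (n≤1+n w))) ⟩
  w * w ^ suc s + (suc w ^ suc s + suc s * suc w ^ suc s) ∎
  where
  open ≤-Reasoning
  expand : ∀ w x s y → suc w * (x + suc s * y) ≡ w * x + (x + suc s * (suc w * y))
  expand = solve-∀

w^[2+t]+[2+t]*w^[1+t]+1≤[1+w]^[2+t] : ∀ w t → w ^ (2 + t) + (2 + t) * w ^ (1 + t) + 1 ≤ suc w ^ (2 + t)
w^[2+t]+[2+t]*w^[1+t]+1≤[1+w]^[2+t] w zero    = ≤-reflexive (identity w)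
  where
  identity : ∀ w → w * (w * 1) + 2 * (w * 1) + 1 ≡ suc w * (suc w * 1)
  identity = solve-∀
w^[2+t]+[2+t]*w^[1+t]+1≤[1+w]^[2+t] w (suc t) = begin
  w * w ^ (2 + t) + (3 + t) * (w * w ^ (1 + t)) + 1
    ≤⟨ m≤m+n _ (w + (2 + t) * w ^ (1 + t)) ⟩
  w * w ^ (2 + t) + (3 + t) * (w * w ^ (1 + t)) + 1 + (w + (2 + t) * w ^ (1 + t))
    ≡⟨ expand w t (w ^ (1 + t)) ⟩
  suc w * (w ^ (2 + t) + (2 + t) * w ^ (1 + t) + 1)
    ≤⟨ *-monoʳ-≤ (suc w) (w^[2+t]+[2+t]*w^[1+t]+1≤[1+w]^[2+t] w t) ⟩
  suc w * suc w ^ (2 + t) ∎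
  where
  open ≤-Reasoning
  expand : ∀ w t y → w * (w * y) + (3 + t) * (w * y) + 1 + (w + (2 + t) * y) ≡ suc w * (w * y + (2 + t) * y + 1)
  expand = solve-∀

exponential-moment : ∀ d (g : ℕ → ℕ → ℕ) Λ X Y → (∀ k j → g k j * Λ ^ (k + j) ≤ X ^ k * Y ^ j) →
  sumBoolFuns d (λ τ → g (count τ) (count (not ∘ τ))) * Λ ^ d ≤ (X + Y) ^ d
exponential-moment d g Λ X Y weight = begin
  sumBoolFuns d (λ τ → g (count τ) (count (not ∘ τ))) * Λ ^ d
    ≡⟨ *-comm _ (Λ ^ d) ⟩
  Λ ^ d * sumBoolFuns d (λ τ → g (count τ) (count (not ∘ τ)))
    ≡⟨ *-distribˡ-sumBoolFuns d (Λ ^ d) _ ⟩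
  sumBoolFuns d (λ τ → Λ ^ d * g (count τ) (count (not ∘ τ)))
    ≤⟨ sumBoolFuns-mono-≤ d termwise ⟩
  sumBoolFuns d (λ τ → X ^ count τ * Y ^ count (not ∘ τ))
    ≡⟨ sumBoolFuns-binomial d X Y ⟩
  (X + Y) ^ d ∎
  where
  open ≤-Reasoning
  termwise : ∀ τ → Λ ^ d * g (count τ) (count (not ∘ τ)) ≤ X ^ count τ * Y ^ count (not ∘ τ)
  termwise τ = begin
    Λ ^ d * g k j         ≡⟨ cong (λ e → Λ ^ e * g k j) (count+count-not τ) ⟨
    Λ ^ (k + j) * g k j   ≡⟨ *-comm (Λ ^ (k + j)) (g k j) ⟩
    g k j * Λ ^ (k + j)   ≤⟨ weight k j ⟩
    X ^ k * Y ^ j         ∎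
    where
    k j : ℕ
    k = count τ
    j = count (not ∘ τ)

-- excess a k j is 1 iff k exceeds (k + j)/2 by more than (k + j)/(2 (1 + a)); this threshold
-- is at most ε (k + j) when ε ≥ 1/(1 + a).
excess : ℕ → ℕ → ℕ → ℕ
excess a k j with 2 * suc a * k ≤? suc (suc a) * (k + j)
... | yes _ = 0
... | no  _ = 1

lopsided : ℕ → ℕ → ℕ → ℕ
lopsided a k j = excess a k j + excess a j k

excess≡0⇒bounded : ∀ a k j → excess a k j ≡ 0 → 2 * suc a * k ≤ suc (suc a) * (k + j)
excess≡0⇒bounded a k j excess≡0 with 2 * suc a * k ≤? suc (suc a) * (k + j)
... | yes bounded = bounded
... | no  _       = contradiction excess≡0 λ ()

lopsidedWords : ℕ → ℕ → ℕ
lopsidedWords a d = sumBoolFuns d (λ τ → lopsided a (count τ) (count (not ∘ τ)))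

-- With m = 1 + a, a word with k trues and j falses has weight X^k Y^j = (u^k w^j)^(2m).
-- If it has excess then 2mk > (m + 1)(k + j), so its weight is at least Λ^(k+j) where
-- Λ = u^(m+1) w^(m-1); and X + Y < 2Λ for w = (m + 1)(2m - 1).
module ChernoffWeights (a : ℕ) where

  s w u X Y Λ : ℕ
  s = suc a + a
  w = suc (suc a) * s
  u = suc w
  X = u ^ suc s
  Y = w ^ suc s
  Λ = u ^ suc (suc a) * w ^ a

  instance
    Λ≢0 : NonZero Λ
    Λ≢0 = m*n≢0 (u ^ suc (suc a)) (w ^ a) {{m^n≢0 u (suc (suc a))}} {{m^n≢0 w a}}

  excess-weight : ∀ k j → excess a k j * Λ ^ (k + j) ≤ X ^ k * Y ^ j
  excess-weight k j with 2 * suc a * k ≤? suc (suc a) * (k + j)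
  ... | yes _        = z≤n
  ... | no  unbounded with m≤n⇒∃[o]m+o≡n (<⇒≤ (≰⇒> unbounded))
  ... | e , A+e≡2[1+a]k = begin
    1 * Λ ^ (k + j)
      ≡⟨ *-identityˡ _ ⟩
    (u ^ suc (suc a) * w ^ a) ^ (k + j)
      ≡⟨ ^-distribʳ-* (u ^ suc (suc a)) (w ^ a) (k + j) ⟩
    (u ^ suc (suc a)) ^ (k + j) * (w ^ a) ^ (k + j)
      ≡⟨ cong₂ _*_ (^-*-assoc u (suc (suc a)) (k + j)) (^-*-assoc w a (k + j)) ⟩
    u ^ A * w ^ (a * (k + j))
      ≡⟨ cong (λ x → u ^ A * w ^ x) a[k+j]≡[1+s]j+e ⟩
    u ^ A * w ^ (suc s * j + e)
      ≤⟨ m≤n⇒n^i*m^[j+e]≤n^[i+e]*m^j (n≤1+n w) A (suc s * j) e ⟩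
    u ^ (A + e) * w ^ (suc s * j)
      ≡⟨ cong (λ x → u ^ x * w ^ (suc s * j)) A+e≡[1+s]k ⟩
    u ^ (suc s * k) * w ^ (suc s * j)
      ≡⟨ cong₂ _*_ (^-*-assoc u (suc s) k) (^-*-assoc w (suc s) j) ⟨
    X ^ k * Y ^ j ∎
    where
    open ≤-Reasoning
    A : ℕ
    A = suc (suc a) * (k + j)
    A+e≡[1+s]k : A + e ≡ suc s * k
    A+e≡[1+s]k = trans A+e≡2[1+a]k (cong (_* k) (2[1+a]≡[1+s] a))
      where
      2[1+a]≡[1+s] : ∀ a → 2 * suc a ≡ suc (suc a + a)
      2[1+a]≡[1+s] = solve-∀
    a[k+j]≡[1+s]j+e : a * (k + j) ≡ suc s * j + e
    a[k+j]≡[1+s]j+e = +-cancelˡ-≡ A _ _ (begin-equality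
      A + a * (k + j)        ≡⟨ split a k j ⟩
      suc s * k + suc s * j  ≡⟨ cong (_+ suc s * j) A+e≡[1+s]k ⟨
      A + e + suc s * j      ≡⟨ +-assoc A e (suc s * j) ⟩
      A + (e + suc s * j)    ≡⟨ cong (_+_ A) (+-comm e (suc s * j)) ⟩
      A + (suc s * j + e)    ∎)
      where
      split : ∀ a k j → suc (suc a) * (k + j) + a * (k + j) ≡ suc (suc a + a) * k + suc (suc a + a) * j
      split = solve-∀

  X+Y<2Λ : X + Y < 2 * Λ
  X+Y<2Λ = begin
    suc (X + Y)
      ≤⟨ s≤s (+-monoˡ-≤ Y ([1+w]^[1+s]≤w^[1+s]+[1+s]*[1+w]^s w s)) ⟩
    suc (Y + suc s * u ^ s + Y)
      ≡⟨ cong (λ x → suc (Y + x + Y)) (double-assoc a (u ^ s)) ⟩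
    suc (Y + 2 * (suc a * u ^ s) + Y)
      ≤⟨ s≤s (+-monoˡ-≤ Y (+-monoʳ-≤ Y (*-monoʳ-≤ 2 ratio))) ⟩
    suc (Y + 2 * (suc (suc a) * w ^ s) + Y)
      ≤⟨ regroup Y (suc (suc a) * w ^ s) (w ^ a) (m^n>0 w a) ⟩
    2 * (Y + suc (suc a) * w ^ s + w ^ a)
      ≡⟨ cong (2 *_) factor-w^a ⟩
    2 * ((w ^ suc (suc a) + suc (suc a) * w ^ suc a + 1) * w ^ a)
      ≤⟨ *-monoʳ-≤ 2 (*-monoˡ-≤ (w ^ a) (w^[2+t]+[2+t]*w^[1+t]+1≤[1+w]^[2+t] w a)) ⟩
    2 * Λ ∎
    where
    open ≤-Reasoning
    double-assoc : ∀ a x → suc (suc a + a) * x ≡ 2 * (suc a * x)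
    double-assoc = solve-∀
    ratio : suc a * u ^ s ≤ suc (suc a) * w ^ s
    ratio = c*[1+D]^s≤[1+c]*D^s (suc a) s w ≤-refl
    regroup : ∀ y z v → 1 ≤ v → suc (y + 2 * z + y) ≤ 2 * (y + z + v)
    regroup y z v 1≤v = subst₂ _≤_ (lhs y z) (rhs y z v) (+-monoʳ-≤ (y + 2 * z + y) (+-mono-≤ 1≤v z≤n))
      where
      lhs : ∀ y z → y + 2 * z + y + (1 + 0) ≡ suc (y + 2 * z + y)
      lhs = solve-∀
      rhs : ∀ y z v → y + 2 * z + y + (v + (v + 0)) ≡ 2 * (y + z + v)
      rhs = solve-∀
    factor-w^a : Y + suc (suc a) * w ^ s + w ^ a
               ≡ (w ^ suc (suc a) + suc (suc a) * w ^ suc a + 1) * w ^ a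
    factor-w^a = begin-equality
      Y + suc (suc a) * w ^ s + w ^ a
        ≡⟨ cong₂ (λ x y → x + suc (suc a) * y + w ^ a)
                 (^-distribˡ-+-* w (suc (suc a)) a) (^-distribˡ-+-* w (suc a) a) ⟩
      w ^ suc (suc a) * w ^ a + suc (suc a) * (w ^ suc a * w ^ a) + w ^ a
        ≡⟨ factor (w ^ suc (suc a)) (suc (suc a)) (w ^ suc a) (w ^ a) ⟩
      (w ^ suc (suc a) + suc (suc a) * w ^ suc a + 1) * w ^ a ∎
      where
      factor : ∀ p c q r → p * r + c * (q * r) + r ≡ (p + c * q + 1) * r
      factor = solve-∀

  lopsidedWords-tail : ∀ d → lopsidedWords a d * Λ ^ d ≤ 2 * (X + Y) ^ d
  lopsidedWords-tail d = begin
    lopsidedWords a d * Λ ^ d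
      ≡⟨ cong (_* Λ ^ d) (sumBoolFuns-distrib-+ d (λ τ → excess a (count τ) (count (not ∘ τ)))
                                                  (λ τ → excess a (count (not ∘ τ)) (count τ))) ⟩
    (S₁ + S₂) * Λ ^ d
      ≡⟨ *-distribʳ-+ (Λ ^ d) S₁ S₂ ⟩
    S₁ * Λ ^ d + S₂ * Λ ^ d
      ≤⟨ +-mono-≤ (exponential-moment d (excess a) Λ X Y excess-weight)
                  (exponential-moment d (λ k j → excess a j k) Λ Y X flipped-weight) ⟩
    (X + Y) ^ d + (Y + X) ^ d
      ≡⟨ cong (λ x → (X + Y) ^ d + x) (trans (cong (_^ d) (+-comm Y X)) (sym (+-identityʳ _))) ⟩
    2 * (X + Y) ^ d ∎
    where
    open ≤-Reasoning
    S₁ S₂ : ℕ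
    S₁ = sumBoolFuns d (λ τ → excess a (count τ) (count (not ∘ τ)))
    S₂ = sumBoolFuns d (λ τ → excess a (count (not ∘ τ)) (count τ))
    flipped-weight : ∀ k j → excess a j k * Λ ^ (k + j) ≤ Y ^ k * X ^ j
    flipped-weight k j =
      subst₂ (λ e p → excess a j k * Λ ^ e ≤ p) (+-comm j k) (*-comm (X ^ j) (Y ^ k)) (excess-weight j k)

lopsidedWords-rare : ∀ a K q → ∃[ D₀ ] ∀ d → D₀ ≤ d → lopsidedWords a d * suc (K * d ^ q) ≤ 2 ^ d
lopsidedWords-rare a K q = suc D , bound
  where
  open ChernoffWeights a
  instance
    X+Y≢0 : NonZero (X + Y)
    X+Y≢0 = >-nonZero (≤-trans (m^n>0 u (suc s)) (m≤m+n X Y))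
  D : ℕ
  D = proj₁ (exp-dominates-poly (X + Y) (2 * suc K) q)
  dominated : ∀ d → D ≤ d → (X + Y) ^ d * (2 * suc K * d ^ q) ≤ suc (X + Y) ^ d
  dominated = proj₂ (exp-dominates-poly (X + Y) (2 * suc K) q)
  bound : ∀ d → suc D ≤ d → lopsidedWords a d * suc (K * d ^ q) ≤ 2 ^ d
  bound d D<d = *-cancelʳ-≤ _ _ (Λ ^ d) {{m^n≢0 Λ d}} (begin
    T * P * Λ ^ d                     ≡⟨ *-assoc T P (Λ ^ d) ⟩
    T * (P * Λ ^ d)                   ≡⟨ cong (T *_) (*-comm P (Λ ^ d)) ⟩
    T * (Λ ^ d * P)                   ≡⟨ *-assoc T (Λ ^ d) P ⟨
    T * Λ ^ d * P                     ≤⟨ *-monoˡ-≤ P (lopsidedWords-tail d) ⟩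
    2 * (X + Y) ^ d * P               ≡⟨ *-assoc 2 ((X + Y) ^ d) P ⟩
    2 * ((X + Y) ^ d * P)             ≡⟨ x∙yz≈y∙xz 2 ((X + Y) ^ d) P ⟩
    (X + Y) ^ d * (2 * P)             ≤⟨ *-monoʳ-≤ ((X + Y) ^ d) 2P≤[2+2K]*d^q ⟩
    (X + Y) ^ d * (2 * suc K * d ^ q) ≤⟨ dominated d (≤-trans (n≤1+n D) D<d) ⟩
    suc (X + Y) ^ d                   ≤⟨ ^-monoˡ-≤ d X+Y<2Λ ⟩
    (2 * Λ) ^ d                       ≡⟨ ^-distribʳ-* 2 Λ d ⟩
    2 ^ d * Λ ^ d                     ∎)
    where
    open ≤-Reasoning
    T P : ℕ
    T = lopsidedWords a d
    P = suc (K * d ^ q)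
    2P≤[2+2K]*d^q : 2 * P ≤ 2 * suc K * d ^ q
    2P≤[2+2K]*d^q = begin
      2 * (1 + K * d ^ q)   ≤⟨ *-monoʳ-≤ 2 (+-monoˡ-≤ (K * d ^ q) (m^n>0 d {{>-nonZero (≤-trans (s≤s z≤n) D<d)}} q)) ⟩
      2 * (suc K * d ^ q)   ≡⟨ *-assoc 2 (suc K) (d ^ q) ⟨
      2 * suc K * d ^ q     ∎

-- Balanced partitions of dense bipartite graphs

Balanced : ℕ → (G : BipGraph) → (Fin (l G) → Bool) → Set
Balanced a G σ = ∀ v → lopsided a (degInPart G σ true v) (degInPart G σ false v) ≡ 0

degInPart-split : ∀ G σ v → degInPart G σ true v + degInPart G σ false v ≡ degR G v
degInPart-split G σ v = count-∧-split (λ u → adj G u v) σ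

balanced-partition : ∀ G a → (∀ v → lopsidedWords a (degR G v) * suc (r G) ≤ 2 ^ degR G v) →
                     ∃[ σ ] Balanced a G σ
balanced-partition G a rare = union-bound (l G) bad rare-at
  where
  bad : Fin (r G) → (Fin (l G) → Bool) → ℕ
  bad v σ = lopsided a (degInPart G σ true v) (degInPart G σ false v)
  rare-at : ∀ v → sumBoolFuns (l G) (bad v) * suc (r G) ≤ 2 ^ l G
  rare-at v = *-cancelʳ-≤ _ _ (2 ^ d) {{m^n≢0 2 d}} (begin
    S * M * 2 ^ d       ≡⟨ *-assoc S M (2 ^ d) ⟩
    S * (M * 2 ^ d)     ≡⟨ cong (S *_) (*-comm M (2 ^ d)) ⟩
    S * (2 ^ d * M)     ≡⟨ *-assoc S (2 ^ d) M ⟨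
    S * 2 ^ d * M       ≡⟨ cong (_* M) (sumBoolFuns-restrict (l G) (λ u → adj G u v) (lopsided a)) ⟩
    2 ^ l G * T * M     ≡⟨ *-assoc (2 ^ l G) T M ⟩
    2 ^ l G * (T * M)   ≤⟨ *-monoʳ-≤ (2 ^ l G) (rare v) ⟩
    2 ^ l G * 2 ^ d     ∎)
    where
    open ≤-Reasoning
    d M S T : ℕ
    d = degR G v
    M = suc (r G)
    S = sumBoolFuns (l G) (bad v)
    T = lopsidedWords a d

dense-graph-balanced : ∀ a K q → ∃[ N ] ∀ G → N ≤ nV G → (∀ v → nV G ≤ K * degR G v ^ q) →
                       ∃[ σ ] Balanced a G σ
dense-graph-balanced a K q = suc (K * D₀ ^ q) , λ G N≤n dense → balanced-partition G a (rare-at G N≤n dense)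
  where
  D₀ : ℕ
  D₀ = proj₁ (lopsidedWords-rare a K q)
  rare : ∀ d → D₀ ≤ d → lopsidedWords a d * suc (K * d ^ q) ≤ 2 ^ d
  rare = proj₂ (lopsidedWords-rare a K q)
  rare-at : ∀ G → suc (K * D₀ ^ q) ≤ nV G → (∀ v → nV G ≤ K * degR G v ^ q) →
            ∀ v → lopsidedWords a (degR G v) * suc (r G) ≤ 2 ^ degR G v
  rare-at G N≤n dense v = ≤-trans (*-monoʳ-≤ (lopsidedWords a d) (s≤s r≤Kd^q)) (rare d D₀≤d)
    where
    d : ℕ
    d = degR G v
    r≤Kd^q : r G ≤ K * d ^ q
    r≤Kd^q = ≤-trans (m≤n+m (r G) (l G)) (dense v)
    D₀≤d : D₀ ≤ d
    D₀≤d = ≮⇒≥ λ d<D₀ → 1+n≰n (≤-trans N≤n (≤-trans (dense v) (*-monoʳ-≤ K (^-monoˡ-≤ q (<⇒≤ d<D₀)))))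

-- Between ℚ and ℕ

toℚᵘ-ℕtoℚ : ∀ n → ℚ.toℚᵘ (ℕtoℚ n) ℚᵘ.≃ mkℚᵘ (+ n) 0
toℚᵘ-ℕtoℚ n = ℚ.toℚᵘ-fromℚᵘ (mkℚᵘ (+ n) 0)

ℕtoℚ-* : ∀ m n → ℕtoℚ m ℚ.* ℕtoℚ n ≡ ℕtoℚ (m * n)
ℕtoℚ-* m n = ℚ.toℚᵘ-injective (begin
  ℚ.toℚᵘ (ℕtoℚ m ℚ.* ℕtoℚ n)                  ≈⟨ ℚ.toℚᵘ-homo-* (ℕtoℚ m) (ℕtoℚ n) ⟩
  ℚ.toℚᵘ (ℕtoℚ m) ℚᵘ.* ℚ.toℚᵘ (ℕtoℚ n)        ≈⟨ ℚᵘ.*-cong (toℚᵘ-ℕtoℚ m) (toℚᵘ-ℕtoℚ n) ⟩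
  mkℚᵘ (+ m) 0 ℚᵘ.* mkℚᵘ (+ n) 0              ≈⟨ *≡* (cong (ℤ._* + 1) (ℤ.pos-* m n)) ⟨
  mkℚᵘ (+ (m * n)) 0                          ≈⟨ toℚᵘ-ℕtoℚ (m * n) ⟨
  ℚ.toℚᵘ (ℕtoℚ (m * n))                       ∎)
  where open ℚᵘ.≃-Reasoning

ℕtoℚ-^ : ∀ m n → ℕtoℚ m ^ℚ n ≡ ℕtoℚ (m ^ n)
ℕtoℚ-^ m zero    = refl
ℕtoℚ-^ m (suc n) = trans (cong (ℕtoℚ m ℚ.*_) (ℕtoℚ-^ m n)) (ℕtoℚ-* m (m ^ n))

ℕtoℚ-mono-≤ : ∀ {m n} → m ≤ n → ℕtoℚ m ℚ.≤ ℕtoℚ n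
ℕtoℚ-mono-≤ {m} {n} m≤n = ℚ.toℚᵘ-cancel-≤
  (ℚᵘ.≤-respˡ-≃ (ℚᵘ.≃-sym (toℚᵘ-ℕtoℚ m)) (ℚᵘ.≤-respʳ-≃ (ℚᵘ.≃-sym (toℚᵘ-ℕtoℚ n))
    (*≤* (subst₂ ℤ._≤_ (sym (ℤ.*-identityʳ (+ m))) (sym (ℤ.*-identityʳ (+ n))) (+≤+ m≤n)))))

ℕtoℚ-cancel-≤ : ∀ {m n} → ℕtoℚ m ℚ.≤ ℕtoℚ n → m ≤ n
ℕtoℚ-cancel-≤ {m} {n} m≤n
  with ℚᵘ.≤-respˡ-≃ (toℚᵘ-ℕtoℚ m) (ℚᵘ.≤-respʳ-≃ (toℚᵘ-ℕtoℚ n) (ℚ.toℚᵘ-mono-≤ m≤n))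
... | *≤* m*1≤n*1 = ℤ.drop‿+≤+ (subst₂ ℤ._≤_ (ℤ.*-identityʳ (+ m)) (ℤ.*-identityʳ (+ n)) m*1≤n*1)

^ℚ-distrib-* : ∀ x y n → (x ℚ.* y) ^ℚ n ≡ x ^ℚ n ℚ.* y ^ℚ n
^ℚ-distrib-* x y zero    = refl
^ℚ-distrib-* x y (suc n) = trans (cong ((x ℚ.* y) ℚ.*_) (^ℚ-distrib-* x y n)) (ℚ-interchange x y (x ^ℚ n) (y ^ℚ n))

[1+e]*[[1+c]/[1+e]]≡1+c : ∀ c e .(cop : Coprime (suc c) (suc e)) →
                          ℕtoℚ (suc e) ℚ.* mkℚ +[1+ c ] e cop ≡ ℕtoℚ (suc c)
[1+e]*[[1+c]/[1+e]]≡1+c c e cop = ℚ.toℚᵘ-injective (begin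
  ℚ.toℚᵘ (ℕtoℚ (suc e) ℚ.* mkℚ +[1+ c ] e cop)  ≈⟨ ℚ.toℚᵘ-homo-* (ℕtoℚ (suc e)) (mkℚ +[1+ c ] e cop) ⟩
  ℚ.toℚᵘ (ℕtoℚ (suc e)) ℚᵘ.* mkℚᵘ +[1+ c ] e   ≈⟨ ℚᵘ.*-congʳ (toℚᵘ-ℕtoℚ (suc e)) ⟩
  mkℚᵘ (+ suc e) 0 ℚᵘ.* mkℚᵘ +[1+ c ] e        ≈⟨ *≡* (cong (λ x → + suc x) (identity c e)) ⟩
  mkℚᵘ (+ suc c) 0                             ≈⟨ toℚᵘ-ℕtoℚ (suc c) ⟨
  ℚ.toℚᵘ (ℕtoℚ (suc c))                        ∎)
  where
  open ℚᵘ.≃-Reasoning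
  identity : ∀ c e → (c + e * suc c) * 1 ≡ e + 0 * suc e + c * suc (e + 0 * suc e)
  identity = solve-∀

n≤n^p : ∀ n p .{{_ : NonZero p}} → n ≤ n ^ p
n≤n^p zero    (suc p) = z≤n
n≤n^p (suc n) (suc p) = subst (_≤ suc n ^ suc p) (*-identityʳ (suc n)) (*-monoʳ-≤ (suc n) (m^n>0 (suc n) p))

degree-bound : ∀ c e .(cop : Coprime (suc c) (suc e)) p q n d .{{_ : NonZero p}} →
  mkℚ +[1+ c ] e cop ^ℚ q ℚ.* ℕtoℚ n ^ℚ p ℚ.≤ ℕtoℚ d ^ℚ q → n ≤ suc e ^ q * d ^ q
degree-bound c e cop p q n d Cn≤d =
  ≤-trans (n≤n^p n p) (≤-trans (m≤n*m (n ^ p) (suc c ^ q) {{m^n≢0 (suc c) q}})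
    (ℕtoℚ-cancel-≤ (subst₂ ℚ._≤_ lhs rhs scaled)))
  where
  C : ℚ
  C = mkℚ +[1+ c ] e cop
  K : ℕ
  K = suc e ^ q
  scaled : ℕtoℚ K ℚ.* (C ^ℚ q ℚ.* ℕtoℚ n ^ℚ p) ℚ.≤ ℕtoℚ K ℚ.* ℕtoℚ d ^ℚ q
  scaled = ℚ.*-monoˡ-≤-nonNeg (ℕtoℚ K) {{ℚ.nonNegative {ℕtoℚ K} (ℕtoℚ-mono-≤ {0} {K} z≤n)}} Cn≤d
  lhs : ℕtoℚ K ℚ.* (C ^ℚ q ℚ.* ℕtoℚ n ^ℚ p) ≡ ℕtoℚ (suc c ^ q * n ^ p)
  lhs = begin
    ℕtoℚ K ℚ.* (C ^ℚ q ℚ.* ℕtoℚ n ^ℚ p)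
      ≡⟨ ℚ.*-assoc (ℕtoℚ K) (C ^ℚ q) _ ⟨
    ℕtoℚ K ℚ.* C ^ℚ q ℚ.* ℕtoℚ n ^ℚ p
      ≡⟨ cong (λ x → x ℚ.* C ^ℚ q ℚ.* ℕtoℚ n ^ℚ p) (ℕtoℚ-^ (suc e) q) ⟨
    ℕtoℚ (suc e) ^ℚ q ℚ.* C ^ℚ q ℚ.* ℕtoℚ n ^ℚ p
      ≡⟨ cong (ℚ._* ℕtoℚ n ^ℚ p) (^ℚ-distrib-* (ℕtoℚ (suc e)) C q) ⟨
    (ℕtoℚ (suc e) ℚ.* C) ^ℚ q ℚ.* ℕtoℚ n ^ℚ p
      ≡⟨ cong (λ x → x ^ℚ q ℚ.* ℕtoℚ n ^ℚ p) ([1+e]*[[1+c]/[1+e]]≡1+c c e cop) ⟩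
    ℕtoℚ (suc c) ^ℚ q ℚ.* ℕtoℚ n ^ℚ p
      ≡⟨ cong₂ ℚ._*_ (ℕtoℚ-^ (suc c) q) (ℕtoℚ-^ n p) ⟩
    ℕtoℚ (suc c ^ q) ℚ.* ℕtoℚ (n ^ p)
      ≡⟨ ℕtoℚ-* (suc c ^ q) (n ^ p) ⟩
    ℕtoℚ (suc c ^ q * n ^ p) ∎
    where open ≡-Reasoning
  rhs : ℕtoℚ K ℚ.* ℕtoℚ d ^ℚ q ≡ ℕtoℚ (K * d ^ q)
  rhs = trans (cong (ℕtoℚ K ℚ.*_) (ℕtoℚ-^ d q)) (ℕtoℚ-* K (d ^ q))

toℚᵘ-deviation : ∀ k d → ℚ.toℚᵘ (ℕtoℚ k ℚ.- + d ℚ./ 2) ℚᵘ.≃ mkℚᵘ (+ k) 0 ℚᵘ.- mkℚᵘ (+ d) 1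
toℚᵘ-deviation k d = ℚᵘ.≃-trans (ℚ.toℚᵘ-homo-+ (ℕtoℚ k) (ℚ.- (+ d ℚ./ 2)))
  (ℚᵘ.+-cong (toℚᵘ-ℕtoℚ k)
             (ℚᵘ.≃-trans (ℚ.toℚᵘ-homo‿- (+ d ℚ./ 2)) (ℚᵘ.-‿cong (ℚ.toℚᵘ-fromℚᵘ (mkℚᵘ (+ d) 1)))))

-- Cross-multiplied: (2k - d)(1 + a) ≤ 2 (1 + s) d, since 2 (1 + a) k ≤ (1 + a) d + d.
deviation≤ᵘ : ∀ s a k d → 2 * suc a * k ≤ suc (suc a) * d →
  mkℚᵘ (+ k) 0 ℚᵘ.- mkℚᵘ (+ d) 1 ℚᵘ.≤ mkℚᵘ +[1+ s ] a ℚᵘ.* mkℚᵘ (+ d) 0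
deviation≤ᵘ s a k d 2[1+a]k≤[2+a]d = *≤* (begin
  (+ k ℤ.* + 2 ℤ.+ ℤ.- (+ d) ℤ.* + 1) ℤ.* + (suc a * 1)
    ≡⟨ cong (λ x → (+ k ℤ.* + 2 ℤ.+ ℤ.- (+ d) ℤ.* + 1) ℤ.* + x) (*-identityʳ (suc a)) ⟩
  (+ k ℤ.* + 2 ℤ.+ ℤ.- (+ d) ℤ.* + 1) ℤ.* A
    ≡⟨ expand (+ k) (+ d) A ⟩
  + 2 ℤ.* A ℤ.* + k ℤ.+ ℤ.- (A ℤ.* + d)
    ≤⟨ ℤ.+-monoˡ-≤ (ℤ.- (A ℤ.* + d)) (subst₂ ℤ._≤_ cast-lhs cast-rhs (+≤+ 2[1+a]k≤[2+a]d)) ⟩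
  + d ℤ.+ A ℤ.* + d ℤ.+ ℤ.- (A ℤ.* + d)
    ≡⟨ cancel (+ d) (A ℤ.* + d) ⟩
  + d
    ≤⟨ +≤+ (≤-trans (m≤n*m d (suc s)) (m≤m*n (suc s * d) 2)) ⟩
  + (suc s * d * 2)
    ≡⟨ trans (ℤ.pos-* (suc s * d) 2) (cong (ℤ._* + 2) (ℤ.pos-* (suc s) d)) ⟩
  (+[1+ s ] ℤ.* + d) ℤ.* + 2 ∎)
  where
  open ℤ.≤-Reasoning
  A : ℤ.ℤ
  A = + suc a
  expand : ∀ K D A → (K ℤ.* + 2 ℤ.+ ℤ.- D ℤ.* + 1) ℤ.* A ≡ + 2 ℤ.* A ℤ.* K ℤ.+ ℤ.- (A ℤ.* D)
  expand = ℤ-Solver.solve-∀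
  cancel : ∀ x y → x ℤ.+ y ℤ.+ ℤ.- y ≡ x
  cancel = ℤ-Solver.solve-∀
  cast-lhs : + (2 * suc a * k) ≡ + 2 ℤ.* A ℤ.* + k
  cast-lhs = trans (ℤ.pos-* (2 * suc a) k) (cong (ℤ._* + k) (ℤ.pos-* 2 (suc a)))
  cast-rhs : + (suc (suc a) * d) ≡ + d ℤ.+ A ℤ.* + d
  cast-rhs = trans (ℤ.pos-+ d (suc a * d)) (cong (ℤ._+_ (+ d)) (ℤ.pos-* (suc a) d))

deviation≤ : ∀ s a k d .(cop : Coprime (suc s) (suc a)) → 2 * suc a * k ≤ suc (suc a) * d →
  ℕtoℚ k ℚ.- + d ℚ./ 2 ℚ.≤ mkℚ +[1+ s ] a cop ℚ.* ℕtoℚ d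
deviation≤ s a k d cop bounded = ℚ.toℚᵘ-cancel-≤
  (ℚᵘ.≤-respˡ-≃ (ℚᵘ.≃-sym (toℚᵘ-deviation k d))
    (ℚᵘ.≤-respʳ-≃ (ℚᵘ.≃-sym toℚᵘ-εd) (deviation≤ᵘ s a k d bounded)))
  where
  toℚᵘ-εd : ℚ.toℚᵘ (mkℚ +[1+ s ] a cop ℚ.* ℕtoℚ d) ℚᵘ.≃ mkℚᵘ +[1+ s ] a ℚᵘ.* mkℚᵘ (+ d) 0
  toℚᵘ-εd = ℚᵘ.≃-trans (ℚ.toℚᵘ-homo-* (mkℚ +[1+ s ] a cop) (ℕtoℚ d))
                       (ℚᵘ.*-congˡ {mkℚᵘ +[1+ s ] a} (toℚᵘ-ℕtoℚ d))

-[k-[k+j]/2]≡j-[k+j]/2 : ∀ k j → ℚ.- (ℕtoℚ k ℚ.- + (k + j) ℚ./ 2) ≡ ℕtoℚ j ℚ.- + (k + j) ℚ./ 2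
-[k-[k+j]/2]≡j-[k+j]/2 k j = ℚ.toℚᵘ-injective (begin
  ℚ.toℚᵘ (ℚ.- (ℕtoℚ k ℚ.- + (k + j) ℚ./ 2))      ≈⟨ ℚ.toℚᵘ-homo‿- _ ⟩
  ℚᵘ.- ℚ.toℚᵘ (ℕtoℚ k ℚ.- + (k + j) ℚ./ 2)       ≈⟨ ℚᵘ.-‿cong (toℚᵘ-deviation k (k + j)) ⟩
  ℚᵘ.- (mkℚᵘ (+ k) 0 ℚᵘ.- mkℚᵘ (+ (k + j)) 1)    ≈⟨ *≡* numerators ⟩
  mkℚᵘ (+ j) 0 ℚᵘ.- mkℚᵘ (+ (k + j)) 1            ≈⟨ toℚᵘ-deviation j (k + j) ⟨
  ℚ.toℚᵘ (ℕtoℚ j ℚ.- + (k + j) ℚ./ 2)             ∎)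
  where
  open ℚᵘ.≃-Reasoning
  negate : ∀ K J → ℤ.- (K ℤ.* + 2 ℤ.+ ℤ.- (K ℤ.+ J) ℤ.* + 1) ℤ.* + 2
                 ≡ (J ℤ.* + 2 ℤ.+ ℤ.- (K ℤ.+ J) ℤ.* + 1) ℤ.* + 2
  negate = ℤ-Solver.solve-∀
  numerators : ℤ.- (+ k ℤ.* + 2 ℤ.+ ℤ.- (+ (k + j)) ℤ.* + 1) ℤ.* + 2
             ≡ (+ j ℤ.* + 2 ℤ.+ ℤ.- (+ (k + j)) ℤ.* + 1) ℤ.* + 2
  numerators rewrite ℤ.pos-+ k j = negate (+ k) (+ j)

p≤q⇒-p≤q⇒∣p∣≤q : ∀ {p q} → p ℚ.≤ q → ℚ.- p ℚ.≤ q → ℚ.∣ p ∣ ℚ.≤ q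
p≤q⇒-p≤q⇒∣p∣≤q {p} {q} p≤q -p≤q with ℚ.∣p∣≡p∨∣p∣≡-p p
... | inj₁ ∣p∣≡p  = subst (ℚ._≤ q) (sym ∣p∣≡p) p≤q
... | inj₂ ∣p∣≡-p = subst (ℚ._≤ q) (sym ∣p∣≡-p) -p≤q

balanced⇒∣deviation∣≤ : ∀ s a k j .(cop : Coprime (suc s) (suc a)) → lopsided a k j ≡ 0 →
  ℚ.∣ ℕtoℚ k ℚ.- + (k + j) ℚ./ 2 ∣ ℚ.≤ mkℚ +[1+ s ] a cop ℚ.* ℕtoℚ (k + j)
balanced⇒∣deviation∣≤ s a k j cop balanced = p≤q⇒-p≤q⇒∣p∣≤q
  (deviation≤ s a k (k + j) cop (excess≡0⇒bounded a k j (m+n≡0⇒m≡0 _ balanced)))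
  (subst (ℚ._≤ mkℚ +[1+ s ] a cop ℚ.* ℕtoℚ (k + j)) (sym (-[k-[k+j]/2]≡j-[k+j]/2 k j))
    (deviation≤ s a j (k + j) cop (subst (λ d → 2 * suc a * j ≤ suc (suc a) * d) (+-comm j k)
      (excess≡0⇒bounded a j k (m+n≡0⇒n≡0 (excess a k j) balanced)))))

balanced⇒EpsGood : ∀ G s a .(cop : Coprime (suc s) (suc a)) σ → Balanced a G σ →
                   EpsGood G (mkℚ +[1+ s ] a cop) σ
balanced⇒EpsGood G s a cop σ balanced v true =
  subst (λ d → ℚ.∣ ℕtoℚ kT ℚ.- + d ℚ./ 2 ∣ ℚ.≤ mkℚ +[1+ s ] a cop ℚ.* ℕtoℚ d)
    (degInPart-split G σ v)
    (balanced⇒∣deviation∣≤ s a kT kF cop (balanced v))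
  where
  kT kF : ℕ
  kT = degInPart G σ true v
  kF = degInPart G σ false v
balanced⇒EpsGood G s a cop σ balanced v false =
  subst (λ d → ℚ.∣ ℕtoℚ kF ℚ.- + d ℚ./ 2 ∣ ℚ.≤ mkℚ +[1+ s ] a cop ℚ.* ℕtoℚ d)
    (trans (+-comm kF kT) (degInPart-split G σ v))
    (balanced⇒∣deviation∣≤ s a kF kT cop (trans (+-comm (excess a kF kT) (excess a kT kF)) (balanced v)))
  where
  kT kF : ℕ
  kT = degInPart G σ true v
  kF = degInPart G σ false v

lemma2p5 : (ε C : ℚ) → Positive ε → Positive C → (p q : ℕ) → p > 0 → q > 0 →
    Σ ℕ (λ N → N > 0 × ((G : BipGraph) → nV G ≥ N → MinDegAtLeast G C p q →
      ∃ (λ (σ : Fin (l G) → Bool) → EpsGood G ε σ)))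
lemma2p5 (mkℚ +[1+ s ] a cε) (mkℚ +[1+ c ] e cC) _ _ p q p>0 _ =
  suc N , s≤s z≤n , λ G 1+N≤n (_ , R-degrees) →
    let σ , balanced = balanced-if-dense G (≤-trans (n≤1+n N) 1+N≤n)
                         (λ v → degree-bound c e cC p q (nV G) (degR G v) {{>-nonZero p>0}} (R-degrees v))
    in  σ , balanced⇒EpsGood G s a cε σ balanced
  where
  N : ℕ
  N = proj₁ (dense-graph-balanced a (suc e ^ q) q)
  balanced-if-dense : ∀ G → N ≤ nV G → (∀ v → nV G ≤ suc e ^ q * degR G v ^ q) → ∃[ σ ] Balanced a G σ
  balanced-if-dense = proj₂ (dense-graph-balanced a (suc e ^ q) q)
lemma2p5 (mkℚ +0         _ _) _                   () _  _ _ _ _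
lemma2p5 (mkℚ -[1+ _ ]   _ _) _                   () _  _ _ _ _
lemma2p5 (mkℚ +[1+ _ ]   _ _) (mkℚ +0       _ _) _  () _ _ _ _
lemma2p5 (mkℚ +[1+ _ ]   _ _) (mkℚ -[1+ _ ] _ _) _  () _ _ _ _
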